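{- Let $\mathcal{C}$ be a category with finite limits, $(T,\eta,\mu)$ a monad and $\Sigma$ an endofunctor on $\mathcal{C}$ with initial algebra and free algebras $\Sigma^{\star}X$, and $\delta^{\Sigma}\colon\Sigma T\to T\Sigma$ a distributive law with Kleisli extension $\bar\Sigma$ and induced Kleisli extension $\overline{\Sigma^{\star}}$ of the free monad $\Sigma^{\star}$. Then $\overline{\Sigma^{\star}}$ preserves affine morphisms: if $p\colon P\to TX$ is affine, then $\overline{\Sigma^{\star}}p=\delta^{\Sigma^{\star}}_X\circ\Sigma^{\star}p\colon\Sigma^{\star}P\to T\Sigma^{\star}X$ is affine.
   Context: $\mathrm{Kl}(T)$: morphisms $X\rightsquigarrow Y$ are $\mathcal{C}$-morphisms $X\to TY$, composition $g\cdot f=\mu\circ Tg\circ f$. A distributive law $\delta\colon FT\to TF$ (natural, $\delta\circ F\eta=\eta F$, $\delta\circ F\mu=\mu F\circ T\delta\circ\delta T$) induces a Kleisli extension $\bar F$ (identity on objects, $\bar Ff=\delta\circ Ff$). The free monad of $\bar\Sigma$ on $\mathrm{Kl}(T)$ is a Kleisli extension $\overline{\Sigma^{\star}}$ of $\Sigma^{\star}$, corresponding to a distributive law $\delta^{\Sigma^{\star}}\colon\Sigma^{\star}T\to T\Sigma^{\star}$. A morphism $p\colon P\to TX$ is affine if $T!\circ p=\eta_1\circ!_P$, equivalently if it factors through the equalizer $i_X\colon T_+X\to TX$ of $\eta_1\circ!$ and $T!$. -}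

module Defs where

open import Level using (Level; _⊔_) renaming (suc to lsuc)
open import Relation.Binary.PropositionalEquality using (_≡_)

record Category (o ℓ : Level) : Set (lsuc (o ⊔ ℓ)) where
  infixr 9 _∘_
  field
    Obj : Set o
    Hom : Obj → Obj → Set ℓ
    id  : ∀ {A} → Hom A A
    _∘_ : ∀ {A B C} → Hom B C → Hom A B → Hom A C
    identityˡ : ∀ {A B} {f : Hom A B} → id ∘ f ≡ f
    identityʳ : ∀ {A B} {f : Hom A B} → f ∘ id ≡ f
    assoc : ∀ {A B C D} {f : Hom A B} {g : Hom B C} {h : Hom C D} →
            (h ∘ g) ∘ f ≡ h ∘ (g ∘ f)

module _ {o ℓ} (C : Category o ℓ) where
  open Category C

  record FiniteLimits : Set (o ⊔ ℓ) where
    field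
      𝟙 : Obj
      ! : ∀ (A : Obj) → Hom A 𝟙
      !-unique : ∀ {A} (f : Hom A 𝟙) → f ≡ ! A
      _×_ : Obj → Obj → Obj
      π₁ : ∀ {A B} → Hom (A × B) A
      π₂ : ∀ {A B} → Hom (A × B) B
      ⟨_,_⟩ : ∀ {X A B} → Hom X A → Hom X B → Hom X (A × B)
      π₁-⟨⟩ : ∀ {X A B} {f : Hom X A} {g : Hom X B} → π₁ ∘ ⟨ f , g ⟩ ≡ f
      π₂-⟨⟩ : ∀ {X A B} {f : Hom X A} {g : Hom X B} → π₂ ∘ ⟨ f , g ⟩ ≡ g
      ⟨⟩-unique : ∀ {X A B} {f : Hom X A} {g : Hom X B} (h : Hom X (A × B)) →
                  π₁ ∘ h ≡ f → π₂ ∘ h ≡ g → h ≡ ⟨ f , g ⟩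
      Eq : ∀ {A B} → Hom A B → Hom A B → Obj
      eq : ∀ {A B} {f g : Hom A B} → Hom (Eq f g) A
      eq-equalizes : ∀ {A B} {f g : Hom A B} → f ∘ eq {f = f} {g} ≡ g ∘ eq
      eq-lift : ∀ {X A B} {f g : Hom A B} (h : Hom X A) → f ∘ h ≡ g ∘ h → Hom X (Eq f g)
      eq-lift-β : ∀ {X A B} {f g : Hom A B} (h : Hom X A) (e : f ∘ h ≡ g ∘ h) →
                  eq ∘ eq-lift h e ≡ h
      eq-lift-unique : ∀ {X A B} {f g : Hom A B} (h : Hom X A) (e : f ∘ h ≡ g ∘ h)
                       (k : Hom X (Eq f g)) → eq ∘ k ≡ h → k ≡ eq-lift h e

  record Endofunctor : Set (o ⊔ ℓ) where
    field
      F₀ : Obj → Obj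
      F₁ : ∀ {A B} → Hom A B → Hom (F₀ A) (F₀ B)
      F-id : ∀ {A} → F₁ (id {A}) ≡ id
      F-∘ : ∀ {A B C} {f : Hom A B} {g : Hom B C} → F₁ (g ∘ f) ≡ F₁ g ∘ F₁ f

  record Monad : Set (o ⊔ ℓ) where
    field
      T : Endofunctor
    open Endofunctor T
    field
      η : ∀ X → Hom X (F₀ X)
      μ : ∀ X → Hom (F₀ (F₀ X)) (F₀ X)
      η-natural : ∀ {X Y} (f : Hom X Y) → η Y ∘ f ≡ F₁ f ∘ η X
      μ-natural : ∀ {X Y} (f : Hom X Y) → μ Y ∘ F₁ (F₁ f) ≡ F₁ f ∘ μ X
      identityˡ-μ : ∀ {X} → μ X ∘ F₁ (η X) ≡ id
      identityʳ-μ : ∀ {X} → μ X ∘ η (F₀ X) ≡ id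
      assoc-μ : ∀ {X} → μ X ∘ F₁ (μ X) ≡ μ X ∘ μ (F₀ X)

  record InitialAlgebra (S : Endofunctor) : Set (o ⊔ ℓ) where
    open Endofunctor S
    field
      μS : Obj
      in₀ : Hom (F₀ μS) μS
      fold : ∀ {A} (a : Hom (F₀ A) A) → Hom μS A
      fold-β : ∀ {A} (a : Hom (F₀ A) A) → fold a ∘ in₀ ≡ a ∘ F₁ (fold a)
      fold-unique : ∀ {A} (a : Hom (F₀ A) A) (h : Hom μS A) →
                    h ∘ in₀ ≡ a ∘ F₁ h → h ≡ fold a

  record FreeAlgebra (S : Endofunctor) (X : Obj) : Set (o ⊔ ℓ) where
    open Endofunctor S
    field
      carrier : Obj
      α : Hom (F₀ carrier) carrier
      ins : Hom X carrier
      fold : ∀ {A} (a : Hom (F₀ A) A) (f : Hom X A) → Hom carrier A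
      fold-ins : ∀ {A} (a : Hom (F₀ A) A) (f : Hom X A) → fold a f ∘ ins ≡ f
      fold-α : ∀ {A} (a : Hom (F₀ A) A) (f : Hom X A) →
               fold a f ∘ α ≡ a ∘ F₁ (fold a f)
      fold-unique : ∀ {A} (a : Hom (F₀ A) A) (f : Hom X A) (h : Hom carrier A) →
                    h ∘ ins ≡ f → h ∘ α ≡ a ∘ F₁ h → h ≡ fold a f

  record DistributiveLaw (M : Monad) (S : Endofunctor) : Set (o ⊔ ℓ) where
    open Monad M
    module T = Endofunctor T
    module S = Endofunctor S
    field
      δ : ∀ X → Hom (S.F₀ (T.F₀ X)) (T.F₀ (S.F₀ X))
      δ-natural : ∀ {X Y} (f : Hom X Y) → δ Y ∘ S.F₁ (T.F₁ f) ≡ T.F₁ (S.F₁ f) ∘ δ X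
      δ-η : ∀ {X} → δ X ∘ S.F₁ (η X) ≡ η (S.F₀ X)
      δ-μ : ∀ {X} → δ X ∘ S.F₁ (μ X) ≡ μ (S.F₀ X) ∘ T.F₁ (δ X) ∘ δ (T.F₀ X)

  module _ {S : Endofunctor} (free : ∀ X → FreeAlgebra S X) where
    open FreeAlgebra

    S⋆₀ : Obj → Obj
    S⋆₀ X = carrier (free X)

    S⋆₁ : ∀ {X Y} → Hom X Y → Hom (S⋆₀ X) (S⋆₀ Y)
    S⋆₁ {X} {Y} f = fold (free X) (α (free Y)) (ins (free Y) ∘ f)

    -- The induced distributive law δ^{S⋆} : S⋆ T → T S⋆, i.e. the unique
    -- S-algebra map from the free algebra S⋆(TX) to the S-algebra
    -- T(S⋆X) with structure T α ∘ δ, extending T ins : TX → T(S⋆X).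
    δ⋆ : (M : Monad) → DistributiveLaw M S → ∀ X →
         Hom (S⋆₀ (Endofunctor.F₀ (Monad.T M) X)) (Endofunctor.F₀ (Monad.T M) (S⋆₀ X))
    δ⋆ M D X =
      fold (free (T.F₀ X)) (T.F₁ (α (free X)) ∘ δ (S⋆₀ X)) (T.F₁ (ins (free X)))
      where open DistributiveLaw D

  IsAffine : (L : FiniteLimits) (M : Monad) {P X : Obj} →
             Hom P (Endofunctor.F₀ (Monad.T M) X) → Set ℓ
  IsAffine L M {P} {X} p =
    Endofunctor.F₁ (Monad.T M) (! X) ∘ p ≡ Monad.η M 𝟙 ∘ ! P
    where open FiniteLimits L

{-# OPTIONS --safe #-}
-- Both T! ∘ δ⋆ ∘ S⋆p and η₁ ∘ ! are S-algebra maps from the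
-- free algebra S⋆P into the algebra T1 (structure T! ∘ δ₁, the lifting of the
-- unique algebra on 1), and on generators both equal T! ∘ p = η₁ ∘ !.
-- Freeness of S⋆P makes them equal, which is affineness.
module Submission where

open import Level using (Level)
open import Defs
open import Relation.Binary.PropositionalEquality
open ≡-Reasoning

module AlgebraMorphisms {o ℓ} (C : Category o ℓ) (S : Endofunctor C) where
  open Category C
  open Endofunctor S
  open FreeAlgebra

  IsAlgebraMorphism : ∀ {A B} → Hom (F₀ A) A → Hom (F₀ B) B → Hom A B → Set ℓ
  IsAlgebraMorphism a b h = h ∘ a ≡ b ∘ F₁ h

  ∘-isAlgebraMorphism : ∀ {A B D} {a : Hom (F₀ A) A} {b : Hom (F₀ B) B} {d : Hom (F₀ D) D}
                          {g : Hom B D} {f : Hom A B} →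
                        IsAlgebraMorphism b d g → IsAlgebraMorphism a b f →
                        IsAlgebraMorphism a d (g ∘ f)
  ∘-isAlgebraMorphism {a = a} {b} {d} {g} {f} g-hom f-hom = begin
    (g ∘ f) ∘ a         ≡⟨ assoc ⟩
    g ∘ (f ∘ a)         ≡⟨ cong (g ∘_) f-hom ⟩
    g ∘ (b ∘ F₁ f)      ≡⟨ sym assoc ⟩
    (g ∘ b) ∘ F₁ f      ≡⟨ cong (_∘ F₁ f) g-hom ⟩
    (d ∘ F₁ g) ∘ F₁ f   ≡⟨ assoc ⟩
    d ∘ (F₁ g ∘ F₁ f)   ≡⟨ cong (d ∘_) (sym F-∘) ⟩
    d ∘ F₁ (g ∘ f)      ∎

  fold-isAlgebraMorphism : ∀ {X A} (F : FreeAlgebra C S X) (a : Hom (F₀ A) A) (f : Hom X A) →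
                           IsAlgebraMorphism (α F) a (fold F a f)
  fold-isAlgebraMorphism F = fold-α F

  free-algebra-ext : ∀ {X A} (F : FreeAlgebra C S X) {a : Hom (F₀ A) A} {h k : Hom (carrier F) A} →
                     IsAlgebraMorphism (α F) a h → IsAlgebraMorphism (α F) a k →
                     h ∘ ins F ≡ k ∘ ins F → h ≡ k
  free-algebra-ext F {a} {h} {k} h-hom k-hom h≡k =
    trans (fold-unique F a (k ∘ ins F) h h≡k h-hom)
          (sym (fold-unique F a (k ∘ ins F) k refl k-hom))

  module _ (L : FiniteLimits C) where
    open FiniteLimits L

    !-isAlgebraMorphism : ∀ {B} (b : Hom (F₀ B) B) → IsAlgebraMorphism b (! (F₀ 𝟙)) (! B)
    !-isAlgebraMorphism b = trans (!-unique _) (sym (!-unique _))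

module Lifting {o ℓ} (C : Category o ℓ) (M : Monad C) (S : Endofunctor C)
               (D : DistributiveLaw C M S) where
  open Category C
  open Monad M
  private
    module T = Endofunctor T
    module S = Endofunctor S
  open DistributiveLaw D using (δ; δ-natural; δ-η)
  open AlgebraMorphisms C S

  lift : ∀ {A} → Hom (S.F₀ A) A → Hom (S.F₀ (T.F₀ A)) (T.F₀ A)
  lift {A} a = T.F₁ a ∘ δ A

  T₁-isAlgebraMorphism : ∀ {A B} {a : Hom (S.F₀ A) A} {b : Hom (S.F₀ B) B} {h : Hom A B} →
                         IsAlgebraMorphism a b h → IsAlgebraMorphism (lift a) (lift b) (T.F₁ h)
  T₁-isAlgebraMorphism {A} {B} {a} {b} {h} h-hom = begin
    T.F₁ h ∘ (T.F₁ a ∘ δ A)                ≡⟨ sym assoc ⟩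
    (T.F₁ h ∘ T.F₁ a) ∘ δ A                ≡⟨ cong (_∘ δ A) (sym T.F-∘) ⟩
    T.F₁ (h ∘ a) ∘ δ A                     ≡⟨ cong (λ g → T.F₁ g ∘ δ A) h-hom ⟩
    T.F₁ (b ∘ S.F₁ h) ∘ δ A                ≡⟨ cong (_∘ δ A) T.F-∘ ⟩
    (T.F₁ b ∘ T.F₁ (S.F₁ h)) ∘ δ A         ≡⟨ assoc ⟩
    T.F₁ b ∘ (T.F₁ (S.F₁ h) ∘ δ A)         ≡⟨ cong (T.F₁ b ∘_) (sym (δ-natural h)) ⟩
    T.F₁ b ∘ (δ B ∘ S.F₁ (T.F₁ h))         ≡⟨ sym assoc ⟩
    (T.F₁ b ∘ δ B) ∘ S.F₁ (T.F₁ h)         ∎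

  η-isAlgebraMorphism : ∀ {A} (a : Hom (S.F₀ A) A) → IsAlgebraMorphism a (lift a) (η A)
  η-isAlgebraMorphism {A} a = begin
    η A ∘ a                         ≡⟨ η-natural a ⟩
    T.F₁ a ∘ η (S.F₀ A)             ≡⟨ cong (T.F₁ a ∘_) (sym δ-η) ⟩
    T.F₁ a ∘ (δ A ∘ S.F₁ (η A))     ≡⟨ sym assoc ⟩
    (T.F₁ a ∘ δ A) ∘ S.F₁ (η A)     ∎

module Affine {o ℓ} (C : Category o ℓ) (L : FiniteLimits C) (M : Monad C) (S : Endofunctor C)
              (D : DistributiveLaw C M S) where
  open Category C
  open FiniteLimits L
  open Monad M
  private
    module T = Endofunctor T
    module S = Endofunctor S
  open FreeAlgebra
  open AlgebraMorphisms C S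
  open Lifting C M S D

  T₁∘-isAffine : ∀ {P X Y} {p : Hom P (T.F₀ X)} (f : Hom X Y) →
                 IsAffine C L M p → IsAffine C L M (T.F₁ f ∘ p)
  T₁∘-isAffine {P} {X} {Y} {p} f p-affine = begin
    T.F₁ (! Y) ∘ (T.F₁ f ∘ p)    ≡⟨ sym assoc ⟩
    (T.F₁ (! Y) ∘ T.F₁ f) ∘ p    ≡⟨ cong (_∘ p) (sym T.F-∘) ⟩
    T.F₁ (! Y ∘ f) ∘ p           ≡⟨ cong (λ g → T.F₁ g ∘ p) (!-unique _) ⟩
    T.F₁ (! X) ∘ p               ≡⟨ p-affine ⟩
    η 𝟙 ∘ ! P                    ∎

  ins-isAffine⇒isAffine : ∀ {P Y} (F : FreeAlgebra C S P) {b : Hom (S.F₀ Y) Y}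
                          {q : Hom (carrier F) (T.F₀ Y)} →
                          IsAlgebraMorphism (α F) (lift b) q →
                          IsAffine C L M (q ∘ ins F) → IsAffine C L M q
  ins-isAffine⇒isAffine {P} {Y} F {b} {q} q-hom q∘ins-affine =
    free-algebra-ext F
      (∘-isAlgebraMorphism (T₁-isAlgebraMorphism (!-isAlgebraMorphism L b)) q-hom)
      (∘-isAlgebraMorphism (η-isAlgebraMorphism (! (S.F₀ 𝟙))) (!-isAlgebraMorphism L (α F)))
      (begin
        (T.F₁ (! Y) ∘ q) ∘ ins F        ≡⟨ assoc ⟩
        T.F₁ (! Y) ∘ (q ∘ ins F)        ≡⟨ q∘ins-affine ⟩
        η 𝟙 ∘ ! P                       ≡⟨ cong (η 𝟙 ∘_) (sym (!-unique _)) ⟩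
        η 𝟙 ∘ (! (carrier F) ∘ ins F)   ≡⟨ sym assoc ⟩
        (η 𝟙 ∘ ! (carrier F)) ∘ ins F   ∎)

module KleisliExtension {o ℓ} (C : Category o ℓ) (M : Monad C) (S : Endofunctor C)
                        (free : ∀ X → FreeAlgebra C S X) (D : DistributiveLaw C M S) where
  open Category C
  open Monad M
  private module T = Endofunctor T
  open FreeAlgebra
  open AlgebraMorphisms C S
  open Lifting C M S D

  kleisli-S⋆₁ : ∀ {P X} → Hom P (T.F₀ X) → Hom (S⋆₀ C free P) (T.F₀ (S⋆₀ C free X))
  kleisli-S⋆₁ {X = X} p = δ⋆ C free M D X ∘ S⋆₁ C free p

  kleisli-S⋆₁-isAlgebraMorphism : ∀ {P X} (p : Hom P (T.F₀ X)) →
                                  IsAlgebraMorphism (α (free P)) (lift (α (free X))) (kleisli-S⋆₁ p)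
  kleisli-S⋆₁-isAlgebraMorphism {P} {X} p =
    ∘-isAlgebraMorphism (fold-isAlgebraMorphism (free (T.F₀ X)) _ _)
                        (fold-isAlgebraMorphism (free P) _ _)

  kleisli-S⋆₁-ins : ∀ {P X} (p : Hom P (T.F₀ X)) →
                    kleisli-S⋆₁ p ∘ ins (free P) ≡ T.F₁ (ins (free X)) ∘ p
  kleisli-S⋆₁-ins {P} {X} p = begin
    (δ⋆ C free M D X ∘ S⋆₁ C free p) ∘ ins (free P)   ≡⟨ assoc ⟩
    δ⋆ C free M D X ∘ (S⋆₁ C free p ∘ ins (free P))   ≡⟨ cong (δ⋆ C free M D X ∘_) (fold-ins (free P) _ _) ⟩
    δ⋆ C free M D X ∘ (ins (free (T.F₀ X)) ∘ p)       ≡⟨ sym assoc ⟩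
    (δ⋆ C free M D X ∘ ins (free (T.F₀ X))) ∘ p       ≡⟨ cong (_∘ p) (fold-ins (free (T.F₀ X)) _ _) ⟩
    T.F₁ (ins (free X)) ∘ p                           ∎

proposition50 : ∀ {o ℓ : Level} (C : Category o ℓ) (L : FiniteLimits C)
                  (M : Monad C) (S : Endofunctor C) (I : InitialAlgebra C S)
                  (free : ∀ X → FreeAlgebra C S X) (D : DistributiveLaw C M S)
                  {P X : Category.Obj C}
                  (p : Category.Hom C P (Endofunctor.F₀ (Monad.T M) X)) →
                  IsAffine C L M p →
                  IsAffine C L M (Category._∘_ C (δ⋆ C free M D X) (S⋆₁ C free p))
proposition50 C L M S _ free D {P} {X} p p-affine =
  ins-isAffine⇒isAffine (free P) (kleisli-S⋆₁-isAlgebraMorphism p)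
    (subst (IsAffine C L M) (sym (kleisli-S⋆₁-ins p))
      (T₁∘-isAffine (FreeAlgebra.ins (free X)) p-affine))
  where
  open Affine C L M S D
  open KleisliExtension C M S free D
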